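{- Let $m\in\mathbb{N}$ and let $\{\{a_1,\dots,a_m\},\{b_1,\dots,b_m\}\}$ be a (non-inclusive or inclusive) $m+m$ sum-and-distance system. Then \[\sum_{j=1}^m(a_j^2+b_j^2)=\begin{cases}\dfrac{1}{3!}(2m)\big((2m)^4-1\big) & \text{in the non-inclusive case},\\[2mm] \dfrac{1}{4!}(2m+1)\big((2m+1)^4-1\big) & \text{in the inclusive case.}\end{cases}\]
   Context: Given positive integers $a_1<\dots<a_m$ and $b_1<\dots<b_m$, the pair $\{\{a_j\},\{b_j\}\}$ is an $m+m$ (non-inclusive) sum-and-distance system if $\{a_j+b_k,\ |a_j-b_k| : j,k\in\{1,\dots,m\}\}=\{1,3,5,\dots,4m^2-1\}$, and an $m+m$ inclusive sum-and-distance system if $\{a_j,\ b_k,\ a_j+b_k,\ |a_j-b_k| : j,k\in\{1,\dots,m\}\}=\{1,2,\dots,2m(m+1)\}$. -}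

module Defs where

open import Data.Nat using (ℕ; zero; suc; _+_; _*_; _<_; _≤_; ∣_-_∣)
open import Data.Fin using (Fin)
open import Data.Product using (_×_; ∃; ∃-syntax)
open import Data.Sum using (_⊎_)
open import Function.Bundles using (_⇔_)
open import Relation.Binary.PropositionalEquality using (_≡_)

PosIncreasing : (m : ℕ) → (Fin m → ℕ) → Set
PosIncreasing m a = (∀ j → 0 < a j) × (∀ j k → Data.Fin._<_ j k → a j < a k)

SumOrDist : (m : ℕ) → (Fin m → ℕ) → (Fin m → ℕ) → ℕ → Set
SumOrDist m a b n = ∃[ j ] ∃[ k ] (n ≡ a j + b k ⊎ n ≡ ∣ a j - b k ∣)

OddUpTo : (m : ℕ) → ℕ → Set
OddUpTo m n = ∃[ t ] (n ≡ 2 * t + 1 × 2 * t + 1 < 4 * (m * m))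

IsSDS : (m : ℕ) → (Fin m → ℕ) → (Fin m → ℕ) → Set
IsSDS m a b = PosIncreasing m a × PosIncreasing m b ×
  (∀ n → SumOrDist m a b n ⇔ OddUpTo m n)

IsInclusiveSDS : (m : ℕ) → (Fin m → ℕ) → (Fin m → ℕ) → Set
IsInclusiveSDS m a b = PosIncreasing m a × PosIncreasing m b ×
  (∀ n → ((∃[ j ] n ≡ a j) ⊎ (∃[ k ] n ≡ b k) ⊎ SumOrDist m a b n)
         ⇔ (1 ≤ n × n ≤ 2 * m * (m + 1)))

ΣFin : (m : ℕ) → (Fin m → ℕ) → ℕ
ΣFin zero f = 0
ΣFin (suc m) f = f Fin.zero + ΣFin m (λ j → f (Fin.suc j))

SumSq : (m : ℕ) → (Fin m → ℕ) → (Fin m → ℕ) → ℕ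
SumSq m a b = ΣFin m (λ j → a j * a j + b j * b j)

-- Write S for the sum of the a_j² and b_j². As (x + y)² + (x - y)² = 2(x² + y²), the 2m² numbers
-- a_j + b_k, |a_j - b_k| have sum of squares 2mS. In a sum-and-distance system they are the 2m² odd
-- numbers below 4m², and since there are exactly as many of them as targets, each target is hit
-- once: the list of sums and distances is a permutation of the targets. So 2mS is the sum of the
-- first 2m² odd squares. In the inclusive case the a_j and b_k join in, giving a list with sum of
-- squares (2m + 1)S that is a permutation of 1, …, 2m(m + 1). The classical formulas for these
-- sums of squares then determine S.
module Submission where

open import Data.Fin as Fin using (Fin)
open import Data.List using (List; []; _∷_; _++_; [_]; length; map; tabulate; applyDownFrom)
open import Data.List.Membership.Propositional using (_∈_)
open import Data.List.Membership.Propositional.Properties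
  using (∈-++⁺ˡ; ∈-++⁺ʳ; ∈-∃++; ∈-tabulate⁺; ∈-applyDownFrom⁻)
open import Data.List.Properties using (length-++; length-tabulate; length-applyDownFrom; map-++)
open import Data.List.Relation.Binary.Permutation.Propositional using (_↭_; prep; ↭-refl; ↭-trans)
open import Data.List.Relation.Binary.Permutation.Propositional.Properties
  using (shift; ∈-resp-↭; ↭-length; map⁺)
open import Data.List.Relation.Binary.Subset.Propositional using (_⊆_)
open import Data.List.Relation.Unary.AllPairs using (_∷_)
open import Data.List.Relation.Unary.Any using (here; there)
open import Data.List.Relation.Unary.Unique.Propositional using (Unique)
open import Data.List.Relation.Unary.Unique.Propositional.Properties
  using (applyDownFrom⁺₁; Unique[x∷xs]⇒x∉xs)
open import Data.Nat using (ℕ; zero; suc; _+_; _*_; _^_; _∸_; _<_; _≤_; ∣_-_∣; s≤s; z≤n; NonZero)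
open import Data.Nat.ListAction using (sum)
open import Data.Nat.ListAction.Properties using (sum-++; sum-↭)
open import Data.Nat.Properties
open import Algebra.Properties.CommutativeSemigroup +-commutativeSemigroup using (interchange)
open import Data.Nat.Tactic.RingSolver using (solve)
open import Data.Product using (_×_; _,_)
open import Data.Sum using (_⊎_; inj₁; inj₂)
open import Function.Base using (_∘_)
open import Function.Bundles using (Equivalence)
open import Relation.Binary.PropositionalEquality
  using (_≡_; refl; sym; trans; cong; cong₂; subst; module ≡-Reasoning)
open import Relation.Nullary using (contradiction)

open import Defs

⊆∧length≡⇒↭ : ∀ {a} {A : Set a} {xs ys : List A} →
              Unique xs → xs ⊆ ys → length ys ≡ length xs → ys ↭ xs
⊆∧length≡⇒↭ {xs = []}     {[]} _ _ _ = ↭-refl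
⊆∧length≡⇒↭ {xs = x ∷ xs} x∷xs!@(_ ∷ xs!) x∷xs⊆ys |ys|≡1+|xs|
  with us , vs , refl ← ∈-∃++ (x∷xs⊆ys (here refl)) =
  ↭-trans ys↭x∷us++vs (prep x (⊆∧length≡⇒↭ xs! xs⊆us++vs |us++vs|≡|xs|))
  where
  ys↭x∷us++vs : us ++ [ x ] ++ vs ↭ x ∷ us ++ vs
  ys↭x∷us++vs = shift x us vs

  xs⊆us++vs : xs ⊆ us ++ vs
  xs⊆us++vs y∈xs with ∈-resp-↭ ys↭x∷us++vs (x∷xs⊆ys (there y∈xs))
  ... | here refl      = contradiction y∈xs (Unique[x∷xs]⇒x∉xs x∷xs!)
  ... | there y∈us++vs = y∈us++vs

  |us++vs|≡|xs| : length (us ++ vs) ≡ length xs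
  |us++vs|≡|xs| = suc-injective (trans (sym (↭-length ys↭x∷us++vs)) |ys|≡1+|xs|)

sumOfSquares : List ℕ → ℕ
sumOfSquares xs = sum (map (λ x → x * x) xs)

sumOfSquares-++ : ∀ xs ys → sumOfSquares (xs ++ ys) ≡ sumOfSquares xs + sumOfSquares ys
sumOfSquares-++ xs ys = trans (cong sum (map-++ _ xs ys)) (sum-++ (map _ xs) _)

sumOfSquares-↭ : {xs ys : List ℕ} → xs ↭ ys → sumOfSquares xs ≡ sumOfSquares ys
sumOfSquares-↭ xs↭ys = sum-↭ (map⁺ _ xs↭ys)

SumSq≡sumOfSquares+sumOfSquares : ∀ m (a b : Fin m → ℕ) →
  SumSq m a b ≡ sumOfSquares (tabulate a) + sumOfSquares (tabulate b)
SumSq≡sumOfSquares+sumOfSquares zero    a b = refl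
SumSq≡sumOfSquares+sumOfSquares (suc m) a b =
  trans (cong (a₀ * a₀ + b₀ * b₀ +_)
              (SumSq≡sumOfSquares+sumOfSquares m (a ∘ Fin.suc) (b ∘ Fin.suc)))
        (interchange (a₀ * a₀) (b₀ * b₀) _ _)
  where
  a₀ = a Fin.zero
  b₀ = b Fin.zero

parallelogram-law-≤ : ∀ {x y} → x ≤ y →
  (x + y) * (x + y) + ∣ x - y ∣ * ∣ x - y ∣ ≡ 2 * (x * x + y * y)
parallelogram-law-≤ {x} x≤y with d , refl ← m≤n⇒∃[o]m+o≡n x≤y rewrite ∣m-m+n∣≡n x d =
  solve (x ∷ d ∷ [])

parallelogram-law : ∀ x y → (x + y) * (x + y) + ∣ x - y ∣ * ∣ x - y ∣ ≡ 2 * (x * x + y * y)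
parallelogram-law x y with ≤-total x y
... | inj₁ x≤y = parallelogram-law-≤ x≤y
... | inj₂ y≤x rewrite +-comm x y | ∣-∣-comm x y | +-comm (x * x) (y * y) = parallelogram-law-≤ y≤x

sumsAndDistancesFrom : ℕ → List ℕ → List ℕ
sumsAndDistancesFrom x []       = []
sumsAndDistancesFrom x (y ∷ ys) = x + y ∷ ∣ x - y ∣ ∷ sumsAndDistancesFrom x ys

sumsAndDistances : List ℕ → List ℕ → List ℕ
sumsAndDistances []       ys = []
sumsAndDistances (x ∷ xs) ys = sumsAndDistancesFrom x ys ++ sumsAndDistances xs ys

inclusiveSumsAndDistances : List ℕ → List ℕ → List ℕ
inclusiveSumsAndDistances xs ys = xs ++ ys ++ sumsAndDistances xs ys

∈-sumsAndDistancesFrom⁺ : ∀ {x y z ys} → y ∈ ys →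
  z ≡ x + y ⊎ z ≡ ∣ x - y ∣ → z ∈ sumsAndDistancesFrom x ys
∈-sumsAndDistancesFrom⁺ (here refl) (inj₁ z≡x+y)   = here z≡x+y
∈-sumsAndDistancesFrom⁺ (here refl) (inj₂ z≡∣x-y∣) = there (here z≡∣x-y∣)
∈-sumsAndDistancesFrom⁺ (there y∈ys) z≡            = there (there (∈-sumsAndDistancesFrom⁺ y∈ys z≡))

∈-sumsAndDistances⁺ : ∀ {x y z xs ys} → x ∈ xs → y ∈ ys →
  z ≡ x + y ⊎ z ≡ ∣ x - y ∣ → z ∈ sumsAndDistances xs ys
∈-sumsAndDistances⁺ (here refl) y∈ys z≡ = ∈-++⁺ˡ (∈-sumsAndDistancesFrom⁺ y∈ys z≡)
∈-sumsAndDistances⁺ {xs = x ∷ _} (there x∈xs) y∈ys z≡ =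
  ∈-++⁺ʳ (sumsAndDistancesFrom x _) (∈-sumsAndDistances⁺ x∈xs y∈ys z≡)

length-sumsAndDistancesFrom : ∀ x ys → length (sumsAndDistancesFrom x ys) ≡ 2 * length ys
length-sumsAndDistancesFrom x []       = refl
length-sumsAndDistancesFrom x (y ∷ ys) =
  trans (cong (2 +_) (length-sumsAndDistancesFrom x ys)) (sym (*-suc 2 (length ys)))

length-sumsAndDistances : ∀ xs ys → length (sumsAndDistances xs ys) ≡ 2 * (length xs * length ys)
length-sumsAndDistances []       ys = refl
length-sumsAndDistances (x ∷ xs) ys = begin
  length (sumsAndDistancesFrom x ys ++ sumsAndDistances xs ys)
    ≡⟨ length-++ (sumsAndDistancesFrom x ys) ⟩
  length (sumsAndDistancesFrom x ys) + length (sumsAndDistances xs ys)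
    ≡⟨ cong₂ _+_ (length-sumsAndDistancesFrom x ys) (length-sumsAndDistances xs ys) ⟩
  2 * length ys + 2 * (length xs * length ys)
    ≡⟨ *-distribˡ-+ 2 (length ys) (length xs * length ys) ⟨
  2 * (length (x ∷ xs) * length ys)
    ∎
  where open ≡-Reasoning

sumOfSquares-sumsAndDistancesFrom : ∀ x ys →
  sumOfSquares (sumsAndDistancesFrom x ys) ≡ 2 * (length ys * (x * x) + sumOfSquares ys)
sumOfSquares-sumsAndDistancesFrom x []       = refl
sumOfSquares-sumsAndDistancesFrom x (y ∷ ys) = begin
  (x + y) * (x + y) + (∣ x - y ∣ * ∣ x - y ∣ + sumOfSquares (sumsAndDistancesFrom x ys))
    ≡⟨ +-assoc ((x + y) * (x + y)) _ _ ⟨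
  ((x + y) * (x + y) + ∣ x - y ∣ * ∣ x - y ∣) + sumOfSquares (sumsAndDistancesFrom x ys)
    ≡⟨ cong₂ _+_ (parallelogram-law x y) (sumOfSquares-sumsAndDistancesFrom x ys) ⟩
  2 * (x * x + y * y) + 2 * (length ys * (x * x) + sumOfSquares ys)
    ≡⟨ *-distribˡ-+ 2 (x * x + y * y) _ ⟨
  2 * ((x * x + y * y) + (length ys * (x * x) + sumOfSquares ys))
    ≡⟨ cong (2 *_) (interchange (x * x) (y * y) _ _) ⟩
  2 * (length (y ∷ ys) * (x * x) + sumOfSquares (y ∷ ys))
    ∎
  where open ≡-Reasoning

sumOfSquares-sumsAndDistances : ∀ xs ys →
  sumOfSquares (sumsAndDistances xs ys) ≡ 2 * (length ys * sumOfSquares xs + length xs * sumOfSquares ys)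
sumOfSquares-sumsAndDistances []       ys = sym (cong (λ z → 2 * (z + 0)) (*-zeroʳ (length ys)))
sumOfSquares-sumsAndDistances (x ∷ xs) ys = begin
  sumOfSquares (sumsAndDistancesFrom x ys ++ sumsAndDistances xs ys)
    ≡⟨ sumOfSquares-++ (sumsAndDistancesFrom x ys) _ ⟩
  sumOfSquares (sumsAndDistancesFrom x ys) + sumOfSquares (sumsAndDistances xs ys)
    ≡⟨ cong₂ _+_ (sumOfSquares-sumsAndDistancesFrom x ys) (sumOfSquares-sumsAndDistances xs ys) ⟩
  2 * (n * (x * x) + Q) + 2 * (n * S + k * Q)
    ≡⟨ *-distribˡ-+ 2 (n * (x * x) + Q) _ ⟨
  2 * ((n * (x * x) + Q) + (n * S + k * Q))
    ≡⟨ cong (2 *_) (interchange (n * (x * x)) Q _ _) ⟩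
  2 * ((n * (x * x) + n * S) + (Q + k * Q))
    ≡⟨ cong (λ z → 2 * (z + (Q + k * Q))) (*-distribˡ-+ n (x * x) S) ⟨
  2 * (n * sumOfSquares (x ∷ xs) + length (x ∷ xs) * Q)
    ∎
  where
  open ≡-Reasoning
  n = length ys
  k = length xs
  S = sumOfSquares xs
  Q = sumOfSquares ys

odds : ℕ → List ℕ
odds = applyDownFrom (λ t → 2 * t + 1)

odds-unique : ∀ n → Unique (odds n)
odds-unique n = applyDownFrom⁺₁ _ n λ j<i _ 2i+1≡2j+1 →
  <⇒≢ j<i (sym (*-cancelˡ-≡ _ _ 2 (+-cancelʳ-≡ 1 _ _ 2i+1≡2j+1)))

sumOfSquares-odds : ∀ n → 3 * sumOfSquares (odds n) + n ≡ 4 * (n * n * n)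
sumOfSquares-odds zero    = refl
sumOfSquares-odds (suc n) = induction-step n (sumOfSquares (odds n)) (sumOfSquares-odds n)
  where
  induction-step : ∀ n Q → 3 * Q + n ≡ 4 * (n * n * n) →
         3 * ((2 * n + 1) * (2 * n + 1) + Q) + suc n ≡ 4 * (suc n * suc n * suc n)
  induction-step n Q ih = begin
    3 * ((2 * n + 1) * (2 * n + 1) + Q) + suc n              ≡⟨ solve (n ∷ Q ∷ []) ⟩
    (3 * Q + n) + (3 * ((2 * n + 1) * (2 * n + 1)) + 1)      ≡⟨ cong (_+ (3 * ((2 * n + 1) * (2 * n + 1)) + 1)) ih ⟩
    4 * (n * n * n) + (3 * ((2 * n + 1) * (2 * n + 1)) + 1)  ≡⟨ solve (n ∷ []) ⟩
    4 * (suc n * suc n * suc n)                              ∎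
    where open ≡-Reasoning

oneTo : ℕ → List ℕ
oneTo = applyDownFrom suc

oneTo-unique : ∀ n → Unique (oneTo n)
oneTo-unique n = applyDownFrom⁺₁ suc n λ j<i _ 1+i≡1+j → <⇒≢ j<i (sym (suc-injective 1+i≡1+j))

sumOfSquares-oneTo : ∀ n → 6 * sumOfSquares (oneTo n) ≡ n * (n + 1) * (2 * n + 1)
sumOfSquares-oneTo zero    = refl
sumOfSquares-oneTo (suc n) = induction-step n (sumOfSquares (oneTo n)) (sumOfSquares-oneTo n)
  where
  induction-step : ∀ n Q → 6 * Q ≡ n * (n + 1) * (2 * n + 1) →
         6 * (suc n * suc n + Q) ≡ suc n * (suc n + 1) * (2 * suc n + 1)
  induction-step n Q ih = begin
    6 * (suc n * suc n + Q)                           ≡⟨ *-distribˡ-+ 6 (suc n * suc n) Q ⟩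
    6 * (suc n * suc n) + 6 * Q                       ≡⟨ cong (6 * (suc n * suc n) +_) ih ⟩
    6 * (suc n * suc n) + n * (n + 1) * (2 * n + 1)   ≡⟨ solve (n ∷ []) ⟩
    suc n * (suc n + 1) * (2 * suc n + 1)             ∎
    where open ≡-Reasoning

m<n⇒2*m+1<2*n : ∀ {m n} → m < n → 2 * m + 1 < 2 * n
m<n⇒2*m+1<2*n {m} {n} m<n = begin-strict
  2 * m + 1    <⟨ +-monoʳ-< (2 * m) (n<1+n 1) ⟩
  2 * m + 2    ≡⟨ *-distribˡ-+ 2 m 1 ⟨
  2 * (m + 1)  ≡⟨ cong (2 *_) (+-comm m 1) ⟩
  2 * suc m    ≤⟨ *-monoʳ-≤ 2 m<n ⟩
  2 * n        ∎
  where open ≤-Reasoning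

IsSDS⇒sumsAndDistances↭odds : ∀ {m a b} → IsSDS m a b →
  sumsAndDistances (tabulate a) (tabulate b) ↭ odds (2 * (m * m))
IsSDS⇒sumsAndDistances↭odds {m} {a} {b} (_ , _ , sds) =
  ⊆∧length≡⇒↭ (odds-unique _) covered equinumerous
  where
  as = tabulate a
  bs = tabulate b

  2t+1<4m² : ∀ {t} → t < 2 * (m * m) → 2 * t + 1 < 4 * (m * m)
  2t+1<4m² {t} t<2m² = subst (2 * t + 1 <_) (sym (*-assoc 2 2 (m * m))) (m<n⇒2*m+1<2*n t<2m²)

  covered : odds (2 * (m * m)) ⊆ sumsAndDistances as bs
  covered y∈odds with t , t<2m² , refl ← ∈-applyDownFrom⁻ _ y∈odds
    with j , k , y≡ ← Equivalence.from (sds _) (t , refl , 2t+1<4m² t<2m²)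
    = ∈-sumsAndDistances⁺ (∈-tabulate⁺ j) (∈-tabulate⁺ k) y≡

  equinumerous : length (sumsAndDistances as bs) ≡ length (odds (2 * (m * m)))
  equinumerous = begin
    length (sumsAndDistances as bs)
      ≡⟨ length-sumsAndDistances as bs ⟩
    2 * (length as * length bs)
      ≡⟨ cong₂ (λ p q → 2 * (p * q)) (length-tabulate a) (length-tabulate b) ⟩
    2 * (m * m)
      ≡⟨ length-applyDownFrom _ _ ⟨
    length (odds (2 * (m * m)))
      ∎
    where open ≡-Reasoning

IsInclusiveSDS⇒inclusiveSumsAndDistances↭oneTo : ∀ {m a b} → IsInclusiveSDS m a b →
  inclusiveSumsAndDistances (tabulate a) (tabulate b) ↭ oneTo (2 * m * (m + 1))
IsInclusiveSDS⇒inclusiveSumsAndDistances↭oneTo {m} {a} {b} (_ , _ , sds) =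
  ⊆∧length≡⇒↭ (oneTo-unique _) covered equinumerous
  where
  as = tabulate a
  bs = tabulate b

  covered : oneTo (2 * m * (m + 1)) ⊆ inclusiveSumsAndDistances as bs
  covered y∈oneTo with i , i<N , refl ← ∈-applyDownFrom⁻ suc y∈oneTo
    with Equivalence.from (sds _) (s≤s z≤n , i<N)
  ... | inj₁ (j , y≡aj)          = ∈-++⁺ˡ (subst (_∈ as) (sym y≡aj) (∈-tabulate⁺ j))
  ... | inj₂ (inj₁ (k , y≡bk))   =
    ∈-++⁺ʳ as (∈-++⁺ˡ (subst (_∈ bs) (sym y≡bk) (∈-tabulate⁺ k)))
  ... | inj₂ (inj₂ (j , k , y≡)) =
    ∈-++⁺ʳ as (∈-++⁺ʳ bs (∈-sumsAndDistances⁺ (∈-tabulate⁺ j) (∈-tabulate⁺ k) y≡))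

  equinumerous : length (inclusiveSumsAndDistances as bs) ≡ length (oneTo (2 * m * (m + 1)))
  equinumerous = begin
    length (as ++ bs ++ sumsAndDistances as bs)
      ≡⟨ length-++ as ⟩
    length as + length (bs ++ sumsAndDistances as bs)
      ≡⟨ cong (length as +_) (trans (length-++ bs) (cong (length bs +_) (length-sumsAndDistances as bs))) ⟩
    length as + (length bs + 2 * (length as * length bs))
      ≡⟨ cong₂ (λ p q → p + (q + 2 * (p * q))) (length-tabulate a) (length-tabulate b) ⟩
    m + (m + 2 * (m * m))
      ≡⟨ solve (m ∷ []) ⟩
    2 * m * (m + 1)
      ≡⟨ length-applyDownFrom suc _ ⟨
    length (oneTo (2 * m * (m + 1)))
      ∎
    where open ≡-Reasoning

sumOfSquares-sumsAndDistances-tabulate : ∀ m (a b : Fin m → ℕ) →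
  sumOfSquares (sumsAndDistances (tabulate a) (tabulate b)) ≡ 2 * m * SumSq m a b
sumOfSquares-sumsAndDistances-tabulate m a b = begin
  sumOfSquares (sumsAndDistances as bs)
    ≡⟨ sumOfSquares-sumsAndDistances as bs ⟩
  2 * (length bs * A + length as * B)
    ≡⟨ cong₂ (λ p q → 2 * (q * A + p * B)) (length-tabulate a) (length-tabulate b) ⟩
  2 * (m * A + m * B)
    ≡⟨ cong (2 *_) (*-distribˡ-+ m A B) ⟨
  2 * (m * (A + B))
    ≡⟨ *-assoc 2 m (A + B) ⟨
  2 * m * (A + B)
    ≡⟨ cong (2 * m *_) (SumSq≡sumOfSquares+sumOfSquares m a b) ⟨
  2 * m * SumSq m a b
    ∎
  where
  open ≡-Reasoning
  as = tabulate a
  bs = tabulate b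
  A = sumOfSquares as
  B = sumOfSquares bs

sumOfSquares-inclusiveSumsAndDistances-tabulate : ∀ m (a b : Fin m → ℕ) →
  sumOfSquares (inclusiveSumsAndDistances (tabulate a) (tabulate b)) ≡ (1 + 2 * m) * SumSq m a b
sumOfSquares-inclusiveSumsAndDistances-tabulate m a b = begin
  sumOfSquares (as ++ bs ++ sumsAndDistances as bs)
    ≡⟨ sumOfSquares-++ as _ ⟩
  A + sumOfSquares (bs ++ sumsAndDistances as bs)
    ≡⟨ cong (A +_) (sumOfSquares-++ bs _) ⟩
  A + (B + sumOfSquares (sumsAndDistances as bs))
    ≡⟨ +-assoc A B _ ⟨
  A + B + sumOfSquares (sumsAndDistances as bs)
    ≡⟨ cong₂ _+_ (sym (SumSq≡sumOfSquares+sumOfSquares m a b))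
                 (sumOfSquares-sumsAndDistances-tabulate m a b) ⟩
  SumSq m a b + 2 * m * SumSq m a b
    ∎
  where
  open ≡-Reasoning
  as = tabulate a
  bs = tabulate b
  A = sumOfSquares as
  B = sumOfSquares bs

m+n≡n*o⇒m≡n*[o∸1] : ∀ {m n o} → m + n ≡ n * o → m ≡ n * (o ∸ 1)
m+n≡n*o⇒m≡n*[o∸1] {m} {n} {o} m+n≡n*o = begin
  m              ≡⟨ m+n∸n≡m m n ⟨
  m + n ∸ n      ≡⟨ cong (_∸ n) m+n≡n*o ⟩
  n * o ∸ n      ≡⟨ cong (n * o ∸_) (*-identityʳ n) ⟨
  n * o ∸ n * 1  ≡⟨ *-distribˡ-∸ n o 1 ⟨
  n * (o ∸ 1)    ∎
  where open ≡-Reasoning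

m^4≡m*[m*[m*m]] : ∀ m → m ^ 4 ≡ m * (m * (m * m))
m^4≡m*[m*[m*m]] m = cong (λ n → m * (m * (m * n))) (*-identityʳ m)

noninclusive-closed-form : ∀ m S .{{_ : NonZero m}} →
  3 * (2 * m * S) + 2 * (m * m) ≡ 4 * (2 * (m * m) * (2 * (m * m)) * (2 * (m * m))) →
  6 * S ≡ 2 * m * ((2 * m) ^ 4 ∸ 1)
noninclusive-closed-form m S eq = m+n≡n*o⇒m≡n*[o∸1] (*-cancelˡ-≡ _ _ m (begin
  m * (6 * S + 2 * m)
    ≡⟨ solve (m ∷ S ∷ []) ⟩
  3 * (2 * m * S) + 2 * (m * m)
    ≡⟨ eq ⟩
  4 * (2 * (m * m) * (2 * (m * m)) * (2 * (m * m)))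
    ≡⟨ solve (m ∷ []) ⟩
  m * (2 * m * (2 * m * (2 * m * (2 * m * (2 * m)))))
    ≡⟨ cong (λ p → m * (2 * m * p)) (m^4≡m*[m*[m*m]] (2 * m)) ⟨
  m * (2 * m * (2 * m) ^ 4)
    ∎))
  where open ≡-Reasoning

inclusive-closed-form : ∀ m S →
  6 * ((1 + 2 * m) * S) ≡ 2 * m * (m + 1) * (2 * m * (m + 1) + 1) * (2 * (2 * m * (m + 1)) + 1) →
  24 * S ≡ (2 * m + 1) * ((2 * m + 1) ^ 4 ∸ 1)
inclusive-closed-form m S eq = m+n≡n*o⇒m≡n*[o∸1] (*-cancelˡ-≡ _ _ (1 + 2 * m) (begin
  (1 + 2 * m) * (24 * S + (2 * m + 1))
    ≡⟨ solve (m ∷ S ∷ []) ⟩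
  4 * (6 * ((1 + 2 * m) * S)) + (2 * m + 1) * (2 * m + 1)
    ≡⟨ cong (λ n → 4 * n + (2 * m + 1) * (2 * m + 1)) eq ⟩
  4 * (2 * m * (m + 1) * (2 * m * (m + 1) + 1) * (2 * (2 * m * (m + 1)) + 1)) + (2 * m + 1) * (2 * m + 1)
    ≡⟨ solve (m ∷ []) ⟩
  (1 + 2 * m) * ((2 * m + 1) * ((2 * m + 1) * ((2 * m + 1) * ((2 * m + 1) * (2 * m + 1)))))
    ≡⟨ cong (λ p → (1 + 2 * m) * ((2 * m + 1) * p)) (m^4≡m*[m*[m*m]] (2 * m + 1)) ⟨
  (1 + 2 * m) * ((2 * m + 1) * (2 * m + 1) ^ 4)
    ∎))
  where open ≡-Reasoning

theorem33 : (m : ℕ) (a b : Fin m → ℕ) →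
    (IsSDS m a b → 6 * SumSq m a b ≡ (2 * m) * ((2 * m) ^ 4 ∸ 1)) ×
    (IsInclusiveSDS m a b → 24 * SumSq m a b ≡ (2 * m + 1) * ((2 * m + 1) ^ 4 ∸ 1))
theorem33 zero      a b = (λ _ → refl) , (λ _ → refl)
theorem33 m@(suc _) a b = noninclusive , inclusive
  where
  open ≡-Reasoning
  S  = SumSq m a b
  as = tabulate a
  bs = tabulate b

  noninclusive : IsSDS m a b → 6 * S ≡ (2 * m) * ((2 * m) ^ 4 ∸ 1)
  noninclusive sds = noninclusive-closed-form m S (begin
    3 * (2 * m * S) + 2 * (m * m)
      ≡⟨ cong (λ s → 3 * s + 2 * (m * m)) (sumOfSquares-sumsAndDistances-tabulate m a b) ⟨
    3 * sumOfSquares (sumsAndDistances as bs) + 2 * (m * m)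
      ≡⟨ cong (λ s → 3 * s + 2 * (m * m)) (sumOfSquares-↭ (IsSDS⇒sumsAndDistances↭odds sds)) ⟩
    3 * sumOfSquares (odds (2 * (m * m))) + 2 * (m * m)
      ≡⟨ sumOfSquares-odds (2 * (m * m)) ⟩
    4 * (2 * (m * m) * (2 * (m * m)) * (2 * (m * m)))
      ∎)

  inclusive : IsInclusiveSDS m a b → 24 * S ≡ (2 * m + 1) * ((2 * m + 1) ^ 4 ∸ 1)
  inclusive isds = inclusive-closed-form m S (begin
    6 * ((1 + 2 * m) * S)
      ≡⟨ cong (6 *_) (sumOfSquares-inclusiveSumsAndDistances-tabulate m a b) ⟨
    6 * sumOfSquares (inclusiveSumsAndDistances as bs)
      ≡⟨ cong (6 *_) (sumOfSquares-↭ (IsInclusiveSDS⇒inclusiveSumsAndDistances↭oneTo isds)) ⟩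
    6 * sumOfSquares (oneTo (2 * m * (m + 1)))
      ≡⟨ sumOfSquares-oneTo (2 * m * (m + 1)) ⟩
    2 * m * (m + 1) * (2 * m * (m + 1) + 1) * (2 * (2 * m * (m + 1)) + 1)
      ∎)
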